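{- Let $\pi\in\mathfrak{S}_n$ and let $\alpha=\pi^{ -1}$ (written in one-line notation, as a tuple in $[n]^n$). Then $$\mathcal{O}^{ -1}(\pi)=\{\delta_I(\alpha): I\subseteq\mathrm{Asc}(\pi)\text{ and no two elements of } I \text{ are consecutive integers}\}.$$
   Context: $[n]=\{1,\ldots,n\}$; $\mathrm{Asc}(\pi)=\{j\in[n-1]:\pi_j<\pi_{j+1}\}$. Parking process: $\alpha=(a_1,\ldots,a_n)\in[n]^n$ encodes preferences of cars $1,\ldots,n$ arriving in order at a one-way street with spots $1,\ldots,n$; car $i$ parks in spot $a_i$ if free, otherwise in the first free spot after $a_i$, if any. $\alpha$ is a parking function if all cars park. A unit interval parking function is a parking function in which each car $i$ parks in spot $a_i$ or $a_i+1$. A Fubini ranking is a tuple $(r_1,\ldots,r_n)\in[n]^n$ with $r_i=1+|\{j:r_j<r_i\}|$ for all $i$. $\mathrm{UFR}_n$ is the set of tuples that are both Fubini rankings and unit interval parking functions. The outcome map $\mathcal{O}:\mathrm{UFR}_n\to\mathfrak{S}_n$ sends $\alpha$ to $\pi_1\cdots\pi_n$ where $\pi_j$ is the car parked in spot $j$; $\mathcal{O}^{ -1}(\pi)=\{\alpha\in\mathrm{UFR}_n:\mathcal{O}(\alpha)=\pi\}$. For $i\in[n-1]$, $\delta_i:\mathrm{UFR}_n\to\mathrm{UFR}_n$ is $\delta_i(\alpha)=\alpha$ if some value among $i-1,i,i+1$ occurs exactly twice in $\alpha$, and otherwise $\delta_i(\alpha)$ is obtained from $\alpha$ by decreasing the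 single occurrence of $i+1$ to $i$. For $I=\{i_1<\cdots<i_k\}\subseteq[n-1]$ with pairwise nonconsecutive elements, $\delta_I=\delta_{i_1}\circ\cdots\circ\delta_{i_k}$, and $\delta_\emptyset$ is the identity. -}

module Defs where

open import Data.Nat using (ℕ; zero; suc; _+_; _∸_; _≤_; _<_; _≤ᵇ_)
open import Data.Nat.Properties using (_≟_; _<?_)
open import Data.Fin using (Fin; toℕ)
open import Data.Fin.Permutation using (Permutation′; _⟨$⟩ʳ_; _⟨$⟩ˡ_)
open import Data.Vec using (Vec; []; _∷_; lookup; replicate; map; tabulate; allFin; toList)
open import Data.List using (List; []; _∷_; length; filter)
open import Data.List.Relation.Unary.All using (All)
open import Data.Maybe using (Maybe; just; nothing; maybe)
open import Data.Bool using (if_then_else_)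
open import Data.Product using (Σ; _×_; ∃)
open import Data.Sum using (_⊎_)
open import Relation.Binary.PropositionalEquality using (_≡_)
open import Relation.Nullary.Decidable using (does)

-- Conventions: a tuple α ∈ [n]^n is a  Vec ℕ n  (values are the actual
-- numbers 1..n).  Cars are indexed by  c : Fin n  (car number toℕ c + 1),
-- spots by  j : Fin n  (spot number toℕ j + 1).

-- One car (c) with preference a walks the street; pos = number of the
-- current spot.  It takes the first free spot whose number is ≥ a;
-- if there is none it does not park (street unchanged).
place : ∀ {n m} → Fin n → ℕ → ℕ → Vec (Maybe (Fin n)) m → Vec (Maybe (Fin n)) m
place c a pos [] = []
place c a pos (nothing ∷ s) =
  if a ≤ᵇ pos then just c ∷ s else nothing ∷ place c a (suc pos) s
place c a pos (just x ∷ s) = just x ∷ place c a (suc pos) s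

runCars : ∀ {n} → Vec ℕ n → List (Fin n) → Vec (Maybe (Fin n)) n → Vec (Maybe (Fin n)) n
runCars α [] s = s
runCars α (c ∷ cs) s = runCars α cs (place c (lookup α c) 1 s)

street : ∀ {n} → Vec ℕ n → Vec (Maybe (Fin n)) n
street {n} α = runCars α (toList (allFin n)) (replicate n nothing)

ParksAt : ∀ {n} → Vec ℕ n → Fin n → Fin n → Set
ParksAt α c j = lookup (street α) j ≡ just c

InRange : ∀ {n} → Vec ℕ n → Set
InRange {n} α = ∀ i → 1 ≤ lookup α i × lookup α i ≤ n

IsParkingFunction : ∀ {n} → Vec ℕ n → Set
IsParkingFunction α = InRange α × (∀ c → ∃ λ j → ParksAt α c j)

IsUnitIntervalPF : ∀ {n} → Vec ℕ n → Set
IsUnitIntervalPF α = IsParkingFunction α ×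
  (∀ c j → ParksAt α c j → (suc (toℕ j) ≡ lookup α c ⊎ suc (toℕ j) ≡ suc (lookup α c)))

countLess : ∀ {n} → ℕ → Vec ℕ n → ℕ
countLess x α = length (filter (λ y → y <? x) (toList α))

count : ∀ {n} → ℕ → Vec ℕ n → ℕ
count x α = length (filter (λ y → y ≟ x) (toList α))

IsFubini : ∀ {n} → Vec ℕ n → Set
IsFubini α = InRange α × (∀ i → lookup α i ≡ suc (countLess (lookup α i) α))

UFR : ∀ {n} → Vec ℕ n → Set
UFR α = IsFubini α × IsUnitIntervalPF α

-- outcome π₁⋯πₙ (πⱼ = number of the car in spot j; 0 if spot empty,
-- which does not happen for parking functions)
outcome : ∀ {n} → Vec ℕ n → Vec ℕ n
outcome α = map (maybe (λ c → suc (toℕ c)) 0) (street α)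

oneLine : ∀ {n} → Permutation′ n → Vec ℕ n
oneLine π = tabulate (λ j → suc (toℕ (π ⟨$⟩ʳ j)))

inverseOneLine : ∀ {n} → Permutation′ n → Vec ℕ n
inverseOneLine π = tabulate (λ i → suc (toℕ (π ⟨$⟩ˡ i)))

-- 1-based access to a permutation's one-line word
val : ∀ {n} → Permutation′ n → ℕ → ℕ
val {n} π k = go (oneLine π) k
  where
  go : ∀ {m} → Vec ℕ m → ℕ → ℕ
  go [] _ = 0
  go (x ∷ xs) zero = 0
  go (x ∷ xs) (suc zero) = x
  go (x ∷ xs) (suc (suc k)) = go xs (suc k)

IsAsc : ∀ {n} → Permutation′ n → ℕ → Set
IsAsc {n} π j = 1 ≤ j × j ≤ n ∸ 1 × val π j < val π (suc j)

delta : ∀ {n} → ℕ → Vec ℕ n → Vec ℕ n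
delta i α =
  if does (count (i ∸ 1) α ≟ 2) then α else
  if does (count i α ≟ 2) then α else
  if does (count (suc i) α ≟ 2) then α else
  map (λ y → if does (y ≟ suc i) then i else y) α

-- a finite set I = {i₁ < ⋯ < i_k} is encoded as the increasing list
-- i₁ ∷ ⋯ ∷ i_k ∷ [];  SparseIncreasing says consecutive list entries
-- differ by at least 2 (increasing + pairwise nonconsecutive).
data SparseIncreasing : List ℕ → Set where
  sp-nil  : SparseIncreasing []
  sp-one  : ∀ x → SparseIncreasing (x ∷ [])
  sp-cons : ∀ x y rest → x + 2 ≤ y → SparseIncreasing (y ∷ rest) →
            SparseIncreasing (x ∷ y ∷ rest)

deltaSet : ∀ {n} → List ℕ → Vec ℕ n → Vec ℕ n
deltaSet [] α = α
deltaSet (i ∷ is) α = delta i (deltaSet is α)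

-- For I ⊆ [n-1], let γ_I be the preference vector in which the car parked in
-- spot s + 1 prefers spot s if s ∈ I and its own spot otherwise, so γ_∅ = π⁻¹.
--
-- If β is a unit interval parking function with outcome π, every car prefers
-- its own spot or the one before, so β = γ_I for the set I of spots whose car
-- prefers the previous spot.  That car was pushed on by the car of spot s,
-- which must have arrived earlier: s is an ascent of π.  Two consecutive
-- s, s + 1 ∈ I would give the cars of spots 1, …, s + 1 preferences at most s,
-- while the Fubini condition at the car of spot s + 2, which prefers s + 1,
-- allows only s preferences below s + 1.
--
-- Conversely, for sparse I ⊆ Asc(π) the cars of γ_I park in arrival order,
-- each in its own spot, and γ_I is a Fubini ranking.  Finally δ_i only
-- relabels the single occurrence of i + 1 in γ_J when min J ≥ i + 2, turning
-- γ_J into γ_{i ∷ J}; hence δ_I(π⁻¹) = γ_I.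
module Submission where

open import Defs
open import Data.Nat as ℕ
  using (ℕ; zero; suc; _+_; _∸_; _≤_; _<_; _≤ᵇ_; z≤n; s≤s; s≤s⁻¹; z<s; s<s; s<s⁻¹)
open import Data.Nat.Properties
open import Data.Fin using (Fin; zero; suc; toℕ; inject₁) renaming (_<_ to _<ᶠ_)
import Data.Fin.Properties as Fin
open import Data.Fin.Permutation using (Permutation′; _⟨$⟩ʳ_; _⟨$⟩ˡ_; inverseʳ; inverseˡ)
open import Data.Vec using (Vec; []; _∷_; lookup; toList; tabulate; tail; replicate; allFin; _[_]≔_)
open import Data.Vec.Properties
  using (lookup∘update; lookup∘update′; tabulate∘lookup; tabulate-cong; lookup∘tabulate; tabulate-∘;
         lookup-map; lookup-replicate)
open import Data.Vec.Relation.Unary.Any.Properties using (tabulate⁻)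
open import Data.Vec.Membership.Propositional using () renaming (_∈_ to _∈ᵥ_)
open import Data.Vec.Membership.Propositional.Properties using (∈-toList⁻; ∈-toList⁺; ∈-allFin⁺)
open import Data.List using (List; []; _∷_; length; filter; map)
open import Data.List.Membership.Propositional using (_∈_; _∉_)
open import Data.List.Membership.DecPropositional _≟_ using (_∈?_)
open import Data.List.Membership.Propositional.Properties using (∈-map∘filter⁻; ∈-map∘filter⁺)
open import Data.List.Relation.Unary.Any using (here; there)
open import Data.List.Relation.Unary.All as All using (All; []; _∷_)
open import Data.List.Relation.Unary.AllPairs using (AllPairs; []; _∷_)
import Data.List.Relation.Unary.AllPairs.Properties as AllPairs
open import Data.List.Relation.Unary.Linked using (Linked; []; [-]; _∷_)
open import Data.List.Relation.Unary.Linked.Properties using (AllPairs⇒Linked)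
open import Data.Maybe using (Maybe; just; nothing; maybe; Is-just)
open import Data.Maybe.Relation.Unary.Any using (just)
open import Data.Maybe.Properties using (just-injective)
open import Data.Bool using (true; false; if_then_else_)
open import Data.Empty using (⊥; ⊥-elim)
open import Data.Unit using (tt)
open import Data.Product using (Σ; _×_; _,_; proj₁; proj₂)
open import Data.Sum using (_⊎_; inj₁; inj₂)
open import Function using (id; _∘_; _∘₂_; case_of_)
open import Function.Bundles using (_⇔_; mk⇔; Equivalence)
open import Relation.Binary.PropositionalEquality
open import Relation.Nullary using (¬_; contradiction; Dec; yes; no; does)
open import Relation.Nullary.Decidable using (dec-true; dec-false)
open import Relation.Nullary.Reflects using (ofʸ; ofⁿ)
open import Relation.Unary as U using (Pred)
open import Algebra.Properties.CommutativeMonoid.Sum +-0-commutativeMonoid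
  using (sum; sum-permute; sum-cong-≗)

Street : ℕ → ℕ → Set
Street N m = Vec (Maybe (Fin N)) m

module _ {N : ℕ} where

  private
    nothing-is-not-just : ¬ Is-just {A = Fin N} nothing
    nothing-is-not-just ()

    ≤-shift : ∀ {a} pos k → a ≤ pos + suc k → a ≤ suc pos + k
    ≤-shift {a} pos k = subst (a ≤_) (+-suc pos k)

  place-parks : ∀ {m} c a pos (s : Street N m) (t : Fin m) →
    lookup s t ≡ nothing → a ≤ pos + toℕ t →
    (∀ j → toℕ j < toℕ t → a ≤ pos + toℕ j → Is-just (lookup s j)) →
    place c a pos s ≡ s [ t ]≔ just c
  place-parks c a pos (nothing ∷ s) zero free a≤ before with a ≤ᵇ pos | ≤ᵇ-reflects-≤ a pos
  ... | true  | _ = refl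
  ... | false | ofⁿ a≰pos = contradiction (subst (a ≤_) (+-identityʳ pos) a≤) a≰pos
  place-parks c a pos (nothing ∷ s) (suc t) free a≤ before with a ≤ᵇ pos | ≤ᵇ-reflects-≤ a pos
  ... | true  | ofʸ a≤pos =
    ⊥-elim (nothing-is-not-just (before zero z<s (subst (a ≤_) (sym (+-identityʳ pos)) a≤pos)))
  ... | false | _ = cong (nothing ∷_) (place-parks c a (suc pos) s t free (≤-shift pos (toℕ t) a≤)
                      (λ j j<t → before (suc j) (s<s j<t) ∘ subst (a ≤_) (sym (+-suc pos (toℕ j)))))
  place-parks c a pos (just d ∷ s) (suc t) free a≤ before =
    cong (just d ∷_) (place-parks c a (suc pos) s t free (≤-shift pos (toℕ t) a≤)
      (λ j j<t → before (suc j) (s<s j<t) ∘ subst (a ≤_) (sym (+-suc pos (toℕ j)))))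

  place-fills : ∀ {m} c pos (s : Street N m) (t : Fin m) →
    lookup s t ≡ nothing → lookup (place c (pos + toℕ t) pos s) t ≡ just c
  place-fills c pos s t free =
    trans (cong (λ s′ → lookup s′ t) (place-parks c (pos + toℕ t) pos s t free ≤-refl
                                        (λ j j<t a≤ → contradiction (+-monoʳ-< pos j<t) (≤⇒≯ a≤))))
          (lookup∘update t s (just c))

  place-keeps : ∀ {m} c a pos (s : Street N m) j {d} →
    lookup s j ≡ just d → lookup (place c a pos s) j ≡ just d
  place-keeps c a pos (nothing ∷ s) (suc j) occ with a ≤ᵇ pos
  ... | true  = occ
  ... | false = place-keeps c a (suc pos) s j occ
  place-keeps c a pos (just e ∷ s) zero    occ = occ
  place-keeps c a pos (just e ∷ s) (suc j) occ = place-keeps c a (suc pos) s j occ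

  place-occupies-only-free : ∀ {m} c a pos (s : Street N m) j {d} →
    lookup s j ≡ nothing → lookup (place c a pos s) j ≡ just d → d ≡ c
  place-occupies-only-free c a pos (nothing ∷ s) zero free occ with a ≤ᵇ pos
  ... | true  = sym (just-injective occ)
  place-occupies-only-free c a pos (nothing ∷ s) (suc j) free occ with a ≤ᵇ pos
  ... | true  = contradiction (trans (sym free) occ) λ ()
  ... | false = place-occupies-only-free c a (suc pos) s j free occ
  place-occupies-only-free c a pos (just e ∷ s) (suc j) free occ =
    place-occupies-only-free c a (suc pos) s j free occ

  runCars-keeps : ∀ (β : Vec ℕ N) cs (s : Street N N) j {d} →
    lookup s j ≡ just d → lookup (runCars β cs s) j ≡ just d
  runCars-keeps β []       s j occ = occ
  runCars-keeps β (c ∷ cs) s j occ = runCars-keeps β cs _ j (place-keeps c (lookup β c) 1 s j occ)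

  -- A car preferring a spot that is still free takes it; so the car that
  -- finally occupies a free spot arrives no later than any car preferring it.
  occupant-arrives-first : ∀ (β : Vec ℕ N) {cs} → AllPairs _<ᶠ_ cs →
    ∀ (s : Street N N) j {c d} → lookup s j ≡ nothing →
    lookup (runCars β cs s) j ≡ just c → d ∈ cs → lookup β d ≡ suc (toℕ j) → toℕ c ≤ toℕ d
  occupant-arrives-first β {e ∷ cs} (e<cs ∷ sorted) s j free occ d∈ pref
    with lookup (place e (lookup β e) 1 s) j in placed
  ... | just x with place-occupies-only-free e (lookup β e) 1 s j free placed
  ...   | refl with just-injective (trans (sym (runCars-keeps β cs _ j placed)) occ) | d∈
  ...     | refl | here refl = ≤-refl
  ...     | refl | there d∈cs = <⇒≤ (All.lookup e<cs d∈cs)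
  occupant-arrives-first β {e ∷ cs} (e<cs ∷ sorted) s j free occ (here refl) pref | nothing =
    contradiction (trans (sym (subst (λ a → lookup (place e a 1 s) j ≡ just e) (sym pref)
                                      (place-fills e 1 s j free))) placed) λ ()
  occupant-arrives-first β {e ∷ cs} (e<cs ∷ sorted) s j free occ (there d∈cs) pref | nothing =
    occupant-arrives-first β sorted _ j placed occ d∈cs pref

tabulate-increasing : ∀ {m N} (f : Fin m → Fin N) → (∀ {i j} → i <ᶠ j → f i <ᶠ f j) →
  AllPairs _<ᶠ_ (toList (tabulate f))
tabulate-increasing {zero}  f mono = []
tabulate-increasing {suc m} f mono =
  All.tabulate (head-below ∘ ∈-toList⁻) ∷ tabulate-increasing (f ∘ suc) (mono ∘ s<s)
  where
  head-below : ∀ {x} → x ∈ᵥ tabulate (f ∘ suc) → f zero <ᶠ x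
  head-below x∈ with _ , refl ← tabulate⁻ x∈ = mono z<s

indicator : ∀ {p} {P : Set p} → Dec P → ℕ
indicator (yes _) = 1
indicator (no _)  = 0

indicator-mono : ∀ {p q} {P : Set p} {Q : Set q} (P? : Dec P) (Q? : Dec Q) →
  (P → Q) → indicator P? ≤ indicator Q?
indicator-mono (yes _) (yes _) _   = ≤-refl
indicator-mono (yes p) (no ¬q) P→Q = contradiction (P→Q p) ¬q
indicator-mono (no _)  _       _   = z≤n

indicator-cong : ∀ {p q} {P : Set p} {Q : Set q} (P? : Dec P) (Q? : Dec Q) →
  P ⇔ Q → indicator P? ≡ indicator Q?
indicator-cong P? Q? P⇔Q =
  ≤-antisym (indicator-mono P? Q? (Equivalence.to P⇔Q)) (indicator-mono Q? P? (Equivalence.from P⇔Q))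

length-filter : ∀ {a p m} {A : Set a} {P : Pred A p} (P? : U.Decidable P) (v : Vec A m) →
  length (filter P? (toList v)) ≡ sum (λ i → indicator (P? (lookup v i)))
length-filter P? []      = refl
length-filter P? (x ∷ v) with P? x
... | yes _ = cong suc (length-filter P? v)
... | no _  = length-filter P? v

sum-mono : ∀ {m} (f g : Fin m → ℕ) → (∀ i → f i ≤ g i) → sum f ≤ sum g
sum-mono {zero}  f g f≤g = z≤n
sum-mono {suc m} f g f≤g = +-mono-≤ (f≤g zero) (sum-mono (f ∘ suc) (g ∘ suc) (f≤g ∘ suc))

sum-indicator-none : ∀ {m p} {P : Pred (Fin m) p} (P? : U.Decidable P) →
  (∀ i → ¬ P i) → sum (λ i → indicator (P? i)) ≡ 0
sum-indicator-none {zero}  P? none = refl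
sum-indicator-none {suc m} P? none with P? zero
... | yes p = contradiction p (none zero)
... | no _  = sum-indicator-none (P? ∘ suc) (none ∘ suc)

sum-indicator-unique : ∀ {m p} {P : Pred (Fin m) p} (P? : U.Decidable P) →
  (∀ {i j} → P i → P j → i ≡ j) → sum (λ i → indicator (P? i)) ≤ 1
sum-indicator-unique {zero}  P? unique = z≤n
sum-indicator-unique {suc m} P? unique with P? zero
... | yes p = ≤-reflexive (cong suc (sum-indicator-none (P? ∘ suc) λ i q → Fin.0≢1+n (unique p q)))
... | no _  = sum-indicator-unique (P? ∘ suc) (Fin.suc-injective ∘₂ unique)

sum-indicator-< : ∀ m k → k ≤ m → sum {m} (λ j → indicator (toℕ j <? k)) ≡ k
sum-indicator-< m       zero    _         = sum-indicator-none {m} (λ j → toℕ j <? 0) λ _ ()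
sum-indicator-< (suc m) (suc k) (s≤s k≤m) = cong suc (begin
  sum {m} (λ j → indicator (suc (toℕ j) <? suc k))
    ≡⟨ sum-cong-≗ {m} (λ j → indicator-cong (suc (toℕ j) <? suc k) (toℕ j <? k) (mk⇔ s<s⁻¹ s<s)) ⟩
  sum {m} (λ j → indicator (toℕ j <? k))
    ≡⟨ sum-indicator-< m k k≤m ⟩
  k ∎)
  where open ≡-Reasoning

m+2≤n⇒1+m<n : ∀ {m n} → m + 2 ≤ n → suc m < n
m+2≤n⇒1+m<n {m} {n} = subst (_≤ n) (+-comm m 2)

sparse-head-least : ∀ {y rest} → SparseIncreasing (y ∷ rest) → All (y ≤_) (y ∷ rest)
sparse-head-least (sp-one y)               = ≤-refl ∷ []
sparse-head-least (sp-cons x y rest x+2≤y sparse) =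
  ≤-refl ∷ All.map (≤-trans (≤-trans (m≤m+n x 2) x+2≤y)) (sparse-head-least sparse)

sparse-tail : ∀ {i is} → SparseIncreasing (i ∷ is) → SparseIncreasing is × All (λ y → i + 2 ≤ y) is
sparse-tail (sp-one i)                     = sp-nil , []
sparse-tail (sp-cons i y rest i+2≤y sparse) = sparse , All.map (≤-trans i+2≤y) (sparse-head-least sparse)

sparse-no-successor : ∀ {I x} → SparseIncreasing I → x ∈ I → suc x ∈ I → ⊥
sparse-no-successor {i ∷ is} sparse (here refl) (here eq) = 1+n≢n eq
sparse-no-successor {i ∷ is} sparse (here refl) (there 1+i∈) =
  n≮n (suc i) (m+2≤n⇒1+m<n (All.lookup (proj₂ (sparse-tail sparse)) 1+i∈))
sparse-no-successor {i ∷ is} sparse (there x∈) (here refl) =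
  <⇒≱ (m+2≤n⇒1+m<n (All.lookup (proj₂ (sparse-tail sparse)) x∈)) (m≤n+m _ 2)
sparse-no-successor {i ∷ is} sparse (there x∈) (there 1+x∈) =
  sparse-no-successor (proj₁ (sparse-tail sparse)) x∈ 1+x∈

linked-sparse : ∀ {I} → Linked _<_ I → (∀ {x} → x ∈ I → suc x ∈ I → ⊥) → SparseIncreasing I
linked-sparse []  _ = sp-nil
linked-sparse [-] _ = sp-one _
linked-sparse {x ∷ y ∷ rest} (x<y ∷ linked) no-successor =
  sp-cons x y rest x+2≤y (linked-sparse linked λ a b → no-successor (there a) (there b))
  where
  x+2≤y : x + 2 ≤ y
  x+2≤y with m≤n⇒m<n∨m≡n x<y
  ... | inj₁ 1+x<y = subst (_≤ y) (+-comm 2 x) 1+x<y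
  ... | inj₂ refl  = ⊥-elim (no-successor (here refl) (there (here refl)))

-- Spots are 0-based and preferences 1-based: preferenceAt I s is the
-- preference, under δ_I(π⁻¹), of the car whose spot has index s.
preferenceAt : List ℕ → ℕ → ℕ
preferenceAt I s with s ∈? I
... | yes _ = s
... | no _  = suc s

module _ {I : List ℕ} {s : ℕ} where

  preferenceAt-∈ : s ∈ I → preferenceAt I s ≡ s
  preferenceAt-∈ s∈I with s ∈? I
  ... | yes _   = refl
  ... | no s∉I = contradiction s∈I s∉I

  preferenceAt-∉ : s ∉ I → preferenceAt I s ≡ suc s
  preferenceAt-∉ s∉I with s ∈? I
  ... | yes s∈I = contradiction s∈I s∉I
  ... | no _    = refl

  preferenceAt-≥ : s ≤ preferenceAt I s
  preferenceAt-≥ with s ∈? I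
  ... | yes _ = ≤-refl
  ... | no _  = n≤1+n s

  preferenceAt-≤ : preferenceAt I s ≤ suc s
  preferenceAt-≤ with s ∈? I
  ... | yes _ = n≤1+n s
  ... | no _  = ≤-refl

  preferenceAt-≤⇒∈ : preferenceAt I s ≤ s → s ∈ I
  preferenceAt-≤⇒∈ p≤s with s ∈? I
  ... | yes s∈I = s∈I
  ... | no _    = contradiction p≤s (1+n≰n)

  preferenceAt-positive : All (1 ≤_) I → 1 ≤ preferenceAt I s
  preferenceAt-positive pos with s ∈? I
  ... | yes s∈I = All.lookup pos s∈I
  ... | no _    = s≤s z≤n

  preferenceAt-≤⇒< : ∀ b → (s ≡ b → s ∉ I) → preferenceAt I s ≤ b → s < b
  preferenceAt-≤⇒< b s≢b p≤b =
    ≤∧≢⇒< (≤-trans preferenceAt-≥ p≤b) λ { refl → s≢b refl (preferenceAt-≤⇒∈ p≤b) }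

-- The values of preferenceAt I are ranked like a Fubini ranking: the spots
-- with a strictly smaller preference than spot s are exactly the first
-- preferenceAt I s ∸ 1 spots.
preferenceAt-<⇔ : ∀ {I} → SparseIncreasing I → All (1 ≤_) I → ∀ s j →
  preferenceAt I j < preferenceAt I s ⇔ j < preferenceAt I s ∸ 1
preferenceAt-<⇔ {I} sparse pos s j with s ∈? I
... | no s∉I =
  mk⇔ (preferenceAt-≤⇒< s (λ { refl → s∉I }) ∘ s≤s⁻¹) (s≤s ∘ ≤-trans preferenceAt-≤)
... | yes s∈I with s
...   | zero    = contradiction (All.lookup pos s∈I) λ ()
...   | suc s′ =
  mk⇔ (preferenceAt-≤⇒< s′ (λ { refl j∈I → sparse-no-successor sparse j∈I s∈I }) ∘ s≤s⁻¹)
      (s≤s ∘ ≤-trans preferenceAt-≤)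

-- `val` reads the one-line word through a helper local to its definition;
-- the unification problem posed by val-tail names that helper valWord.
mutual
  valWord : ∀ {n} → Permutation′ n → ℕ → ∀ {m} → Vec ℕ m → ℕ → ℕ
  valWord = _

  val-tail : ∀ {n} (π : Permutation′ (suc n)) k →
    val π (suc (suc k)) ≡ valWord π (suc (suc k)) (tail (oneLine π)) (suc k)
  val-tail {n} π k with tail (oneLine π)
  ... | word with ℕ.suc (ℕ.suc k)
  ... | position with ℕ.suc k
  ... | index with ℕ.suc n
  ... | length = refl

valWord-tabulate : ∀ {n} (π : Permutation′ n) k {m} (f : Fin m → ℕ) j →
  valWord π k (tabulate f) (suc (toℕ j)) ≡ f j
valWord-tabulate π k f zero    = refl
valWord-tabulate π k f (suc j) = valWord-tabulate π k (f ∘ suc) j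

val-lookup : ∀ {n} (π : Permutation′ n) j → val π (suc (toℕ j)) ≡ suc (toℕ (π ⟨$⟩ʳ j))
val-lookup π zero    = refl
val-lookup π (suc j) = trans (val-tail π (toℕ j)) (valWord-tabulate π (suc (suc (toℕ j))) _ j)

does-cong : ∀ {p q} {P : Set p} {Q : Set q} (P? : Dec P) (Q? : Dec Q) → P ⇔ Q → does P? ≡ does Q?
does-cong (yes _) (yes _) _   = refl
does-cong (yes p) (no ¬q) P⇔Q = contradiction (Equivalence.to P⇔Q p) ¬q
does-cong (no ¬p) (yes q) P⇔Q = contradiction (Equivalence.from P⇔Q q) ¬p
does-cong (no _)  (no _)  _   = refl

lookup-ext : ∀ {a m} {A : Set a} {v w : Vec A m} → (∀ j → lookup v j ≡ lookup w j) → v ≡ w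
lookup-ext {v = v} {w} v≗w = trans (sym (tabulate∘lookup v)) (trans (tabulate-cong v≗w) (tabulate∘lookup w))

previous-spot : ∀ {m} (j : Fin m) → 1 ≤ toℕ j → Σ (Fin m) λ j′ → toℕ j ≡ suc (toℕ j′)
previous-spot (suc i) _ = inject₁ i , cong suc (sym (Fin.toℕ-inject₁ i))

relabel : ℕ → ℕ → ℕ
relabel i y = if does (y ≟ suc i) then i else y

relabel-≡ : ∀ {i y} → y ≡ suc i → relabel i y ≡ i
relabel-≡ {i} {y} y≡1+i = cong (if_then i else y) (dec-true (y ≟ suc i) y≡1+i)

relabel-≢ : ∀ {i y} → y ≢ suc i → relabel i y ≡ y
relabel-≢ {i} {y} y≢1+i = cong (if_then i else y) (dec-false (y ≟ suc i) y≢1+i)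

module _ {n : ℕ} (π : Permutation′ n) where

  car : Fin n → Fin n
  car j = π ⟨$⟩ʳ j

  spot : Fin n → Fin n
  spot c = π ⟨$⟩ˡ c

  car-spot : ∀ c → car (spot c) ≡ c
  car-spot c = inverseʳ π

  spot-car : ∀ j → spot (car j) ≡ j
  spot-car j = inverseˡ π

  car-injective : ∀ {j j′} → car j ≡ car j′ → j ≡ j′
  car-injective {j} {j′} eq = trans (sym (spot-car j)) (trans (cong spot eq) (spot-car j′))

  count-by-spot : ∀ {p} {P : Pred ℕ p} (P? : U.Decidable P) (β : Vec ℕ n) →
    length (filter P? (toList β)) ≡ sum (λ j → indicator (P? (lookup β (car j))))
  count-by-spot P? β = trans (length-filter P? β) (sum-permute _ π)

  ascent-intro : ∀ j′ j → toℕ j ≡ suc (toℕ j′) → car j′ <ᶠ car j → IsAsc π (toℕ j)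
  ascent-intro j′ j j≡1+j′ lt = subst (IsAsc π) (sym j≡1+j′) (s≤s z≤n , bounded , ordered)
    where
    bounded : suc (toℕ j′) ≤ n ∸ 1
    bounded = subst (_≤ n ∸ 1) j≡1+j′ (∸-monoˡ-≤ 1 (Fin.toℕ<n j))
    ordered : val π (suc (toℕ j′)) < val π (suc (suc (toℕ j′)))
    ordered = subst₂ _<_ (sym (val-lookup π j′))
      (sym (trans (cong (val π ∘ suc) (sym j≡1+j′)) (val-lookup π j))) (s<s lt)

  ascent-cars : ∀ j′ j → toℕ j ≡ suc (toℕ j′) → IsAsc π (toℕ j) → car j′ <ᶠ car j
  ascent-cars j′ j j≡1+j′ (_ , _ , ordered) = s<s⁻¹ (subst₂ _<_
    (trans (cong (val π) j≡1+j′) (val-lookup π j′)) (val-lookup π j) ordered)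

  preferences : List ℕ → Vec ℕ n
  preferences I = tabulate (λ c → preferenceAt I (toℕ (spot c)))

  lookup-preferences : ∀ I j → lookup (preferences I) (car j) ≡ preferenceAt I (toℕ j)
  lookup-preferences I j =
    trans (lookup∘tabulate _ (car j)) (cong (preferenceAt I ∘ toℕ) (spot-car j))

  count-preferences : ∀ {p} {P : Pred ℕ p} (P? : U.Decidable P) I →
    length (filter P? (toList (preferences I))) ≡ sum {n} (λ j → indicator (P? (preferenceAt I (toℕ j))))
  count-preferences P? I = trans (count-by-spot P? (preferences I))
    (sum-cong-≗ {n} (cong (indicator ∘ P?) ∘ lookup-preferences I))

  module _ {i : ℕ} {I : List ℕ} (far : All (λ y → i + 2 ≤ y) I) where

    preferenceAt-below-gap : ∀ s → preferenceAt I s ≤ suc i → preferenceAt I s ≡ suc s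
    preferenceAt-below-gap s p≤1+i with s ∈? I
    ... | yes s∈I = contradiction (m+2≤n⇒1+m<n (≤-trans (All.lookup far s∈I) p≤1+i)) (n≮n (suc i))
    ... | no _    = refl

    count-preferences-≤1 : ∀ x → x ≤ suc i → count x (preferences I) ≤ 1
    count-preferences-≤1 x x≤1+i = begin
      count x (preferences I)
        ≡⟨ count-preferences (_≟ x) I ⟩
      sum {n} (λ j → indicator (preferenceAt I (toℕ j) ≟ x))
        ≤⟨ sum-indicator-unique (λ j → preferenceAt I (toℕ j) ≟ x) same-spot ⟩
      1 ∎
      where
      open ≤-Reasoning
      spot-of : ∀ {j : Fin n} → preferenceAt I (toℕ j) ≡ x → suc (toℕ j) ≡ x
      spot-of {j} p≡x = trans (sym (preferenceAt-below-gap (toℕ j) (subst (_≤ suc i) (sym p≡x) x≤1+i))) p≡x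
      same-spot : ∀ {j j′ : Fin n} → preferenceAt I (toℕ j) ≡ x → preferenceAt I (toℕ j′) ≡ x → j ≡ j′
      same-spot p q = Fin.toℕ-injective (suc-injective (trans (spot-of p) (sym (spot-of q))))

    relabel-preferenceAt : ∀ s → relabel i (preferenceAt I s) ≡ preferenceAt (i ∷ I) s
    relabel-preferenceAt s = case s ∈? I of λ where
      (yes s∈I) → begin
        relabel i (preferenceAt I s) ≡⟨ cong (relabel i) (preferenceAt-∈ s∈I) ⟩
        relabel i s                  ≡⟨ relabel-≢ (λ s≡1+i → n≮n (suc i) (m+2≤n⇒1+m<n
                                          (subst (i + 2 ≤_) s≡1+i (All.lookup far s∈I)))) ⟩
        s                            ≡⟨ preferenceAt-∈ (there s∈I) ⟨
        preferenceAt (i ∷ I) s       ∎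
      (no s∉I) → trans (cong (relabel i) (preferenceAt-∉ s∉I)) (case s ≟ i of λ where
        (yes s≡i) → trans (relabel-≡ (cong suc s≡i)) (sym (trans (preferenceAt-∈ (here s≡i)) s≡i))
        (no s≢i)  → trans (relabel-≢ (s≢i ∘ suc-injective))
                      (sym (preferenceAt-∉ λ { (here s≡i) → s≢i s≡i ; (there s∈I) → s∉I s∈I })))
     where open ≡-Reasoning

    count-preferences-≢2 : ∀ x → x ≤ suc i → does (count x (preferences I) ≟ 2) ≡ false
    count-preferences-≢2 x x≤1+i = dec-false (count x (preferences I) ≟ 2)
      λ twice → 1+n≰n (subst (_≤ 1) twice (count-preferences-≤1 x x≤1+i))

    -- No value up to i + 1 occurs twice in preferences I, so none of the
    -- guards of delta i fires.
    delta-preferences : delta i (preferences I) ≡ preferences (i ∷ I)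
    delta-preferences
      rewrite count-preferences-≢2 (i ∸ 1) (≤-trans (m∸n≤m i 1) (n≤1+n i))
            | count-preferences-≢2 i (n≤1+n i)
            | count-preferences-≢2 (suc i) ≤-refl
      = trans (sym (tabulate-∘ _ _)) (tabulate-cong (relabel-preferenceAt ∘ toℕ ∘ spot))

  deltaSet-preferences : ∀ {I} → SparseIncreasing I → deltaSet I (inverseOneLine π) ≡ preferences I
  deltaSet-preferences sp-nil = refl
  deltaSet-preferences {i ∷ I} sparse =
    trans (cong (delta i) (deltaSet-preferences (proj₁ (sparse-tail sparse))))
          (delta-preferences (proj₂ (sparse-tail sparse)))

  preferences-inRange : ∀ {I} → All (1 ≤_) I → InRange (preferences I)
  preferences-inRange {I} positive c rewrite lookup∘tabulate (λ c → preferenceAt I (toℕ (spot c))) c =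
    preferenceAt-positive positive , ≤-trans (preferenceAt-≤ {I}) (Fin.toℕ<n (spot c))

  module _ {I : List ℕ} (sparse : SparseIncreasing I) (positive : All (1 ≤_) I) where

    countLess-preferences : ∀ t →
      countLess (preferenceAt I (toℕ t)) (preferences I) ≡ preferenceAt I (toℕ t) ∸ 1
    countLess-preferences t = begin
      countLess v (preferences I)                      ≡⟨ count-preferences (_<? v) I ⟩
      sum {n} (λ j → indicator (preferenceAt I (toℕ j) <? v))
        ≡⟨ sum-cong-≗ {n} (λ j → indicator-cong _ _ (preferenceAt-<⇔ sparse positive (toℕ t) (toℕ j))) ⟩
      sum {n} (λ j → indicator (toℕ j <? v ∸ 1))       ≡⟨ sum-indicator-< n (v ∸ 1) v∸1≤n ⟩
      v ∸ 1                                            ∎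
      where
      open ≡-Reasoning
      v : ℕ
      v = preferenceAt I (toℕ t)
      v∸1≤n : v ∸ 1 ≤ n
      v∸1≤n = ≤-trans (∸-monoˡ-≤ 1 (preferenceAt-≤ {I})) (<⇒≤ (Fin.toℕ<n t))

    preferences-fubini : IsFubini (preferences I)
    preferences-fubini = preferences-inRange positive , λ c →
      subst (λ v → v ≡ suc (countLess v (preferences I))) (sym (lookup∘tabulate _ c))
        (sym (trans (cong suc (countLess-preferences (spot c)))
                    (m+[n∸m]≡n (preferenceAt-positive positive))))

  -- A sufficient condition for every car to park in its own spot.
  ParksInOwnSpot : Vec ℕ n → Set
  ParksInOwnSpot β = ∀ c →
    lookup β c ≡ suc (toℕ (spot c)) ⊎
    (lookup β c ≡ toℕ (spot c) × ∀ j → toℕ (spot c) ≡ suc (toℕ j) → car j <ᶠ c)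

  streetAfter : ℕ → Street n n
  streetAfter k = tabulate (λ j → if does (toℕ (car j) <? k) then just (car j) else nothing)

  module _ {k : ℕ} {j : Fin n} where

    lookup-streetAfter-< : toℕ (car j) < k → lookup (streetAfter k) j ≡ just (car j)
    lookup-streetAfter-< lt = trans (lookup∘tabulate _ j)
      (cong (if_then just (car j) else nothing) (dec-true (toℕ (car j) <? k) lt))

    lookup-streetAfter-≮ : ¬ toℕ (car j) < k → lookup (streetAfter k) j ≡ nothing
    lookup-streetAfter-≮ ≮ = trans (lookup∘tabulate _ j)
      (cong (if_then just (car j) else nothing) (dec-false (toℕ (car j) <? k) ≮))

    lookup-streetAfter-suc : toℕ (car j) ≢ k → lookup (streetAfter k) j ≡ lookup (streetAfter (suc k)) j
    lookup-streetAfter-suc ≢k = trans (lookup∘tabulate _ j) (trans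
      (cong (if_then just (car j) else nothing)
            (does-cong (toℕ (car j) <? k) (toℕ (car j) <? suc k)
                       (mk⇔ m<n⇒m<1+n (λ lt → ≤∧≢⇒< (s≤s⁻¹ lt) ≢k))))
      (sym (lookup∘tabulate _ j)))

  module _ {β : Vec ℕ n} (parks : ParksInOwnSpot β) where

    place-streetAfter : ∀ c → place c (lookup β c) 1 (streetAfter (toℕ c)) ≡ streetAfter (suc (toℕ c))
    place-streetAfter c = trans (place-parks c (lookup β c) 1 (streetAfter (toℕ c)) (spot c) free a≤ before)
                                (lookup-ext updated)
      where
      free : lookup (streetAfter (toℕ c)) (spot c) ≡ nothing
      free = lookup-streetAfter-≮ (n≮n (toℕ c) ∘ subst (λ d → toℕ d < toℕ c) (car-spot c))
      a≤ : lookup β c ≤ 1 + toℕ (spot c)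
      a≤ with parks c
      ... | inj₁ own        = ≤-reflexive own
      ... | inj₂ (prev , _) = ≤-trans (≤-reflexive prev) (n≤1+n _)
      before : ∀ j → toℕ j < toℕ (spot c) → lookup β c ≤ 1 + toℕ j → Is-just (lookup (streetAfter (toℕ c)) j)
      before j j<t a≤1+j with parks c
      ... | inj₁ own = contradiction (s≤s⁻¹ (subst (_≤ suc (toℕ j)) own a≤1+j)) (<⇒≱ j<t)
      ... | inj₂ (prev , earlier) =
        subst Is-just
          (sym (lookup-streetAfter-< (earlier j (≤-antisym (subst (_≤ suc (toℕ j)) prev a≤1+j) j<t))))
          (just tt)
      updated : ∀ j → lookup (streetAfter (toℕ c) [ spot c ]≔ just c) j ≡ lookup (streetAfter (suc (toℕ c))) j
      updated j with j Fin.≟ spot c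
      ... | yes refl = trans (lookup∘update (spot c) (streetAfter (toℕ c)) (just c))
        (sym (trans (lookup-streetAfter-< (subst (λ d → toℕ d < suc (toℕ c)) (sym (car-spot c))
                                                 (n<1+n (toℕ c))))
                    (cong just (car-spot c))))
      ... | no j≢t = trans (lookup∘update′ j≢t (streetAfter (toℕ c)) (just c))
        (lookup-streetAfter-suc λ car≡c → j≢t (trans (sym (spot-car j)) (cong spot (Fin.toℕ-injective car≡c))))

    runCars-streetAfter : ∀ m (g : Fin m → Fin n) k → (∀ i → toℕ (g i) ≡ k + toℕ i) → m + k ≡ n →
      runCars β (toList (tabulate g)) (streetAfter k) ≡ streetAfter n
    runCars-streetAfter zero    g k _   m+k≡n = cong streetAfter m+k≡n
    runCars-streetAfter (suc m) g k g≡k+ m+k≡n = begin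
      runCars β (toList (tabulate (g ∘ suc))) (place (g zero) (lookup β (g zero)) 1 (streetAfter k))
        ≡⟨ cong (runCars β (toList (tabulate (g ∘ suc)))) first-parks ⟩
      runCars β (toList (tabulate (g ∘ suc))) (streetAfter (suc k))
        ≡⟨ runCars-streetAfter m (g ∘ suc) (suc k) (λ i → trans (g≡k+ (suc i)) (+-suc k (toℕ i)))
                               (trans (+-suc m k) m+k≡n) ⟩
      streetAfter n
        ∎
      where
      open ≡-Reasoning
      first-parks : place (g zero) (lookup β (g zero)) 1 (streetAfter k) ≡ streetAfter (suc k)
      first-parks = subst (λ k → place (g zero) (lookup β (g zero)) 1 (streetAfter k) ≡ streetAfter (suc k))
                          (trans (g≡k+ zero) (+-identityʳ k)) (place-streetAfter (g zero))

    parks-street : ∀ j → lookup (street β) j ≡ just (car j)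
    parks-street j = begin
      lookup (runCars β (toList (allFin n)) (replicate n nothing)) j
        ≡⟨ cong (λ s → lookup (runCars β (toList (allFin n)) s) j) empty ⟩
      lookup (runCars β (toList (allFin n)) (streetAfter 0)) j
        ≡⟨ cong (λ s → lookup s j) (runCars-streetAfter n id 0 (λ _ → refl) (+-identityʳ n)) ⟩
      lookup (streetAfter n) j
        ≡⟨ lookup-streetAfter-< (Fin.toℕ<n (car j)) ⟩
      just (car j)
        ∎
      where
      open ≡-Reasoning
      empty : replicate n nothing ≡ streetAfter 0
      empty = lookup-ext λ j → trans (lookup-replicate j nothing) (sym (lookup-streetAfter-≮ {0} λ ()))

    parks-outcome : outcome β ≡ oneLine π
    parks-outcome = lookup-ext λ j → trans (lookup-map j _ (street β))
      (trans (cong (maybe (suc ∘ toℕ) 0) (parks-street j)) (sym (lookup∘tabulate _ j)))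

    parks-unitInterval : InRange β → IsUnitIntervalPF β
    parks-unitInterval inRange =
      (inRange , λ c → spot c , trans (parks-street (spot c)) (cong just (car-spot c))) , unit
      where
      unit : ∀ c j → ParksAt β c j → suc (toℕ j) ≡ lookup β c ⊎ suc (toℕ j) ≡ suc (lookup β c)
      unit c j parked
        with trans (sym (spot-car j)) (cong spot (just-injective (trans (sym (parks-street j)) parked)))
      ... | refl with parks c
      ...   | inj₁ own        = inj₁ (sym own)
      ...   | inj₂ (prev , _) = inj₂ (cong suc (sym prev))

  preferences-parksInOwnSpot : ∀ {I} → All (IsAsc π) I → ParksInOwnSpot (preferences I)
  preferences-parksInOwnSpot {I} ascents c = case toℕ (spot c) ∈? I of λ where
    (yes s∈I) → inj₂ (trans (lookup∘tabulate _ c) (preferenceAt-∈ s∈I) , λ j s≡1+j →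
                  subst (car j <ᶠ_) (car-spot c) (ascent-cars j (spot c) s≡1+j (All.lookup ascents s∈I)))
    (no s∉I)  → inj₁ (trans (lookup∘tabulate _ c) (preferenceAt-∉ s∉I))

  preferences-outcome : ∀ {I} → SparseIncreasing I → All (IsAsc π) I →
    UFR (preferences I) × outcome (preferences I) ≡ oneLine π
  preferences-outcome {I} sparse ascents =
    (preferences-fubini sparse positive , parks-unitInterval parks (preferences-inRange positive)) ,
    parks-outcome parks
    where
    positive : All (1 ≤_) I
    positive = All.map proj₁ ascents
    parks : ParksInOwnSpot (preferences I)
    parks = preferences-parksInOwnSpot ascents

  module _ {β : Vec ℕ n} where

    outcome-street : outcome β ≡ oneLine π → ∀ j → lookup (street β) j ≡ just (car j)
    outcome-street out j = decode (begin
      maybe (suc ∘ toℕ) 0 (lookup (street β) j) ≡⟨ lookup-map j _ (street β) ⟨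
      lookup (outcome β) j                      ≡⟨ cong (λ v → lookup v j) out ⟩
      lookup (oneLine π) j                      ≡⟨ lookup∘tabulate _ j ⟩
      suc (toℕ (car j))                         ∎)
      where
      open ≡-Reasoning
      decode : ∀ {x} → maybe (suc ∘ toℕ) 0 x ≡ suc (toℕ (car j)) → x ≡ just (car j)
      decode {nothing} ()
      decode {just d} eq = cong just (Fin.toℕ-injective (suc-injective eq))

    own-or-previous : IsUnitIntervalPF β → (∀ j → lookup (street β) j ≡ just (car j)) →
      ∀ c → lookup β c ≡ suc (toℕ (spot c)) ⊎ lookup β c ≡ toℕ (spot c)
    own-or-previous (_ , unit) parked c with unit c (spot c) (trans (parked (spot c)) (cong just (car-spot c)))
    ... | inj₁ own  = inj₁ (sym own)
    ... | inj₂ prev = inj₂ (sym (suc-injective prev))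

  module Preimage {β : Vec ℕ n} (ufr : UFR β) (out : outcome β ≡ oneLine π) where

    private
      fubini : IsFubini β
      fubini = proj₁ ufr
      parked : ∀ j → lookup (street β) j ≡ just (car j)
      parked = outcome-street out
      preference : ∀ c → lookup β c ≡ suc (toℕ (spot c)) ⊎ lookup β c ≡ toℕ (spot c)
      preference = own-or-previous (proj₂ ufr) parked

    PrefersPrevious : Fin n → Set
    PrefersPrevious j = lookup β (car j) ≡ toℕ j

    preference-≤ : ∀ j → lookup β (car j) ≤ suc (toℕ j)
    preference-≤ j with preference (car j)
    ... | inj₁ own  = ≤-reflexive (trans own (cong (suc ∘ toℕ) (spot-car j)))
    ... | inj₂ prev = ≤-trans (≤-reflexive (trans prev (cong toℕ (spot-car j)))) (n≤1+n _)

    no-consecutive : ∀ {j₁ j₂} → toℕ j₂ ≡ suc (toℕ j₁) → PrefersPrevious j₁ → PrefersPrevious j₂ → ⊥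
    no-consecutive {j₁} {j₂} j₂≡1+j₁ previous₁ previous₂ = 1+n≰n (≤-trans lower (≤-reflexive rank))
      where
      y : ℕ
      y = toℕ j₁
      v₂ : lookup β (car j₂) ≡ suc y
      v₂ = trans previous₂ j₂≡1+j₁
      rank : countLess (suc y) β ≡ y
      rank = suc-injective (sym (subst (λ v → v ≡ suc (countLess v β)) v₂ (proj₂ fubini (car j₂))))
      below : ∀ j → toℕ j < suc y → lookup β (car j) < suc y
      below j j<1+y with toℕ j ≟ y
      ... | yes j≡y = s≤s (≤-reflexive (trans (cong (lookup β ∘ car) (Fin.toℕ-injective j≡y)) previous₁))
      ... | no j≢y  = s≤s (≤-trans (preference-≤ j) (≤∧≢⇒< (s≤s⁻¹ j<1+y) j≢y))
      lower : suc y ≤ countLess (suc y) β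
      lower = begin
        suc y
          ≡⟨ sum-indicator-< n (suc y) (subst (_≤ n) j₂≡1+j₁ (<⇒≤ (Fin.toℕ<n j₂))) ⟨
        sum {n} (λ j → indicator (toℕ j <? suc y))
          ≤⟨ sum-mono _ _ (λ j → indicator-mono _ _ (below j)) ⟩
        sum {n} (λ j → indicator (lookup β (car j) <? suc y))
          ≡⟨ count-by-spot (_<? suc y) β ⟨
        countLess (suc y) β ∎
        where open ≤-Reasoning

    previous-ascent : ∀ {j} → PrefersPrevious j → IsAsc π (toℕ j)
    previous-ascent {j} previous with previous-spot j (subst (1 ≤_) previous (proj₁ (proj₁ fubini (car j))))
    ... | j′ , j≡1+j′ = ascent-intro j′ j j≡1+j′ (≤∧≢⇒< first distinct)
      where
      first : toℕ (car j′) ≤ toℕ (car j)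
      first = occupant-arrives-first β (tabulate-increasing id id) (replicate n nothing) j′
        (lookup-replicate j′ nothing) (parked j′) (∈-toList⁺ (∈-allFin⁺ (car j))) (trans previous j≡1+j′)
      distinct : toℕ (car j′) ≢ toℕ (car j)
      distinct eq = 1+n≢n (sym
        (subst (λ i → toℕ j ≡ suc (toℕ i)) (car-injective (Fin.toℕ-injective eq)) j≡1+j′))

    prefersPrevious? : U.Decidable PrefersPrevious
    prefersPrevious? j = lookup β (car j) ≟ toℕ j

    previousSpots : List ℕ
    previousSpots = map toℕ (filter prefersPrevious? (toList (allFin n)))

    ∈-previousSpots⁻ : ∀ {s} → s ∈ previousSpots → Σ (Fin n) λ j → s ≡ toℕ j × PrefersPrevious j
    ∈-previousSpots⁻ s∈
      with j , _ , s≡j , previous ← ∈-map∘filter⁻ toℕ prefersPrevious? {f = toℕ} {xs = toList (allFin n)} s∈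
      = j , s≡j , previous

    ∈-previousSpots⁺ : ∀ {j} → PrefersPrevious j → toℕ j ∈ previousSpots
    ∈-previousSpots⁺ {j} previous = ∈-map∘filter⁺ toℕ prefersPrevious? {f = toℕ}
      (j , ∈-toList⁺ (∈-allFin⁺ j) , refl , previous)

    previousSpots-sparse : SparseIncreasing previousSpots
    previousSpots-sparse = linked-sparse
      (AllPairs⇒Linked (AllPairs.map⁺ {R = _<_} {f = toℕ}
        (AllPairs.filter⁺ prefersPrevious? (tabulate-increasing id id))))
      no-successor
      where
      no-successor : ∀ {x} → x ∈ previousSpots → suc x ∈ previousSpots → ⊥
      no-successor x∈ 1+x∈ with j₁ , refl , previous₁ ← ∈-previousSpots⁻ x∈
                           with j₂ , 1+j₁≡j₂ , previous₂ ← ∈-previousSpots⁻ 1+x∈ =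
        no-consecutive (sym 1+j₁≡j₂) previous₁ previous₂

    previousSpots-ascents : All (IsAsc π) previousSpots
    previousSpots-ascents = All.tabulate ascent
      where
      ascent : ∀ {s} → s ∈ previousSpots → IsAsc π s
      ascent s∈ with j , refl , previous ← ∈-previousSpots⁻ s∈ = previous-ascent previous

    preferences-previousSpots : β ≡ preferences previousSpots
    preferences-previousSpots = lookup-ext λ c → trans (from-preference c) (sym (lookup∘tabulate _ c))
      where
      not-previous : ∀ c → lookup β c ≡ suc (toℕ (spot c)) → toℕ (spot c) ∉ previousSpots
      not-previous c own s∈ with j , s≡j , previous ← ∈-previousSpots⁻ s∈
                            with refl ← Fin.toℕ-injective s≡j =
        1+n≢n (trans (sym own) (trans (cong (lookup β) (sym (car-spot c))) previous))
      from-preference : ∀ c → lookup β c ≡ preferenceAt previousSpots (toℕ (spot c))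
      from-preference c with preference c
      ... | inj₂ prev =
        trans prev (sym (preferenceAt-∈ (∈-previousSpots⁺ (trans (cong (lookup β) (car-spot c)) prev))))
      ... | inj₁ own  = trans own (sym (preferenceAt-∉ (not-previous c own)))

    deltaSet-witness :
      Σ (List ℕ) λ I → SparseIncreasing I × All (IsAsc π) I × β ≡ deltaSet I (inverseOneLine π)
    deltaSet-witness = previousSpots , previousSpots-sparse , previousSpots-ascents ,
      trans preferences-previousSpots (sym (deltaSet-preferences previousSpots-sparse))

proposition4p5 : (n : ℕ) (π : Permutation′ n) (β : Vec ℕ n) →
    (UFR β × outcome β ≡ oneLine π)
      ⇔ Σ (List ℕ) (λ I → SparseIncreasing I × All (IsAsc π) I × β ≡ deltaSet I (inverseOneLine π))
proposition4p5 n π β = mk⇔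
  (λ (ufr , out) → Preimage.deltaSet-witness π ufr out)
  (λ (I , sparse , ascents , β≡δ) → subst (λ α → UFR α × outcome α ≡ oneLine π)
     (sym (trans β≡δ (deltaSet-preferences π sparse))) (preferences-outcome π sparse ascents))
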